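{- Let $p$ be a prime, $m$ a positive integer divisible by $3$, $n=\frac m3(p-1)$, $U=[0,n]^2$, let $i$ be an integer with $0\le i\le n$, and let $J_i$ be an ideal of $U$. (i) Let $J_0,\dots,J_{i-1}$ be a forward consistent sequence of ideals of $U$. Then $J_i$ is consistent with $J_0,\dots,J_{i-1}$ if and only if $\bigl[J_j+D-(i-j)(0,p)\bigr]\cap U\subseteq J_i$ for all $0\le j<i$, and $\bigl[J_i+D+(a,0)\bigr]\cap U\subseteq J_{i-ap-b}$ and $\bigl[J_i+D+(a+1,-p^2+pb)\bigr]\cap U\subseteq J_{i-ap-b}$ for all $a,b\in\mathbb{Z}$ with $a\ge0$, $0\le b\le p-1$, $ap+b\le i$. (ii) Let $J_{i+1},\dots,J_n$ be a backward consistent sequence of ideals of $U$. Then $J_i$ is consistent with $J_{i+1},\dots,J_n$ if and only if $\bigl[J_i+D-(j-i)(0,p)\bigr]\cap U\subseteq J_j$ for all $i<j\le n$, and $\bigl[J_{i+ap+b}+D+(a,0)\bigr]\cap U\subseteq J_i$ and $\bigl[J_{i+ap+b}+D+(a+1,-p^2+pb)\bigr]\cap U\subseteq J_i$ for all $a,b\in\mathbb{Z}$ with $a\ge0$, $0\le b\le p-1$, $i+ap+b\le n$.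
   Context: $D=\{(x,y)\in\mathbb{R}^2: x+py\le 0,\ p^2x+y\le 0\}$ and $\Delta=\{(x,y,z)\in\mathbb{R}^3: x+py+p^2z\le 0,\ p^2x+y+pz\le 0,\ px+p^2y+z\le 0\}$. For $u,v\in\mathbb{R}^2$, $u\prec v$ means $u\in v+D$; for $u,v\in\mathbb{R}^3$, $u\prec v$ means $u\in v+\Delta$. An ideal of $\Omega$ is $I\subseteq\Omega$ with $u\in I$, $v\in\Omega$, $v\prec u\Rightarrow v\in I$. $[a,b]=\{x\in\mathbb{Z}:a\le x\le b\}$; sums are Minkowski sums. $J_0,\dots,J_{i-1}$ is forward consistent if $\bigcup_{j=0}^{i-1}(J_j\times\{j\})$ is an ideal of $U\times[0,i-1]$, and $J_i$ is consistent with it if $J_0,\dots,J_i$ is forward consistent; $J_{i+1},\dots,J_n$ is backward consistent if $\bigcup_{j=i+1}^{n}(J_j\times\{j\})$ is an ideal of $U\times[i+1,n]$, and $J_i$ is consistent with it if $J_i,\dots,J_n$ is backward consistent. -}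

module Defs where

open import Data.Integer using (ℤ; +_; _+_; _-_; _*_; -_; _≤_; _<_)
open import Data.Product using (_×_; _,_; ∃)

-- Points of ℤ² and ℤ³.  All sets in the lemma are subsets of integer
-- points (U = [0,n]², U × [0,k]), so membership in the real cones D, Δ
-- is only ever tested on integer difference vectors.
Pt2 : Set
Pt2 = ℤ × ℤ

Pt3 : Set
Pt3 = ℤ × ℤ × ℤ

Sub : Set → Set₁
Sub A = A → Set

_⊆_ : {A : Set} → Sub A → Sub A → Set
_⊆_ {A} X Y = (u : A) → X u → Y u

InD : ℤ → Pt2 → Set
InD p (x , y) = (x + p * y ≤ + 0) × (p * p * x + y ≤ + 0)

InΔ : ℤ → Pt3 → Set
InΔ p (x , y , z) =
  (x + p * y + p * p * z ≤ + 0) × (p * p * x + y + p * z ≤ + 0) × (p * x + p * p * y + z ≤ + 0)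

sub2 : Pt2 → Pt2 → Pt2
sub2 (x , y) (x' , y') = (x - x' , y - y')

add2 : Pt2 → Pt2 → Pt2
add2 (x , y) (x' , y') = (x + x' , y + y')

sub3 : Pt3 → Pt3 → Pt3
sub3 (x , y , z) (x' , y' , z') = (x - x' , y - y' , z - z')

_≺₂[_]_ : Pt2 → ℤ → Pt2 → Set
u ≺₂[ p ] v = InD p (sub2 u v)

_≺₃[_]_ : Pt3 → ℤ → Pt3 → Set
u ≺₃[ p ] v = InΔ p (sub3 u v)

IsIdeal : {A : Set} → (A → A → Set) → Sub A → Sub A → Set
IsIdeal {A} _≺_ Ω I = (I ⊆ Ω) × ((u v : A) → I u → Ω v → v ≺ u → I v)

InInterval : ℤ → ℤ → ℤ → Set
InInterval a b x = (a ≤ x) × (x ≤ b)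

U : ℤ → Sub Pt2
U n (x , y) = InInterval (+ 0) n x × InInterval (+ 0) n y

UBox : ℤ → ℤ → ℤ → Sub Pt3
UBox n lo hi (x , y , k) = U n (x , y) × InInterval lo hi k

Layers : (ℤ → Sub Pt2) → ℤ → ℤ → Sub Pt3
Layers J lo hi (x , y , k) = InInterval lo hi k × J k (x , y)

-- Forward consistency of J_0..J_{i-1} is Consistent p n J 0 (i-1);
-- backward consistency of J_{i+1}..J_n is Consistent p n J (i+1) n.
Consistent : ℤ → ℤ → (ℤ → Sub Pt2) → ℤ → ℤ → Set
Consistent p n J lo hi = IsIdeal (λ u v → u ≺₃[ p ] v) (UBox n lo hi) (Layers J lo hi)

IdealU : ℤ → ℤ → Sub Pt2 → Set
IdealU p n J = IsIdeal (λ u v → u ≺₂[ p ] v) (U n) J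

ShiftD∩U : ℤ → ℤ → Sub Pt2 → Pt2 → Sub Pt2
ShiftD∩U p n A w u = U n u × ∃ λ v → A v × InD p (sub2 u (add2 v w))

ShiftIncl : ℤ → ℤ → Sub Pt2 → Pt2 → Sub Pt2 → Set
ShiftIncl p n A w B = ShiftD∩U p n A w ⊆ B

-- Consistency of a family of layers says exactly that, for every two layers s and t, layer t
-- contains every point of U lying ≺-below a point of layer s.  Adding one layer to a consistent
-- family therefore only adds the conditions for the pairs involving the new layer, and these
-- are translated into shifted inclusions by a description of Δ in terms of D: for a layer
-- difference z ≥ 0, (x, y, z) ∈ Δ iff (x, y + zP) ∈ D; for z = −(aP + b) with a ≥ 0 and
-- 0 ≤ b < P, (x, y, z) ∈ Δ iff (x − a, y) ∈ D or (x − a − 1, y + P² − Pb) ∈ D.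
module Submission where

open import Defs
open import Data.Nat using (ℕ)
open import Data.Nat.Primality using (Prime)
open import Data.Nat.Divisibility using (_∣_)
open import Data.Nat.DivMod using (_/_)
open import Data.Integer using (ℤ; +_; _+_; _-_; _*_; -_; _≤_; _<_)
open import Data.Product using (_×_; _,_)
open import Function.Bundles using (_⇔_)
import Data.Nat as N

open import Data.Nat.Primality using (prime⇒nonZero)
import Data.Nat.DivMod as ℕ
import Data.Nat.Properties as ℕ
open import Data.Integer using (+≤+; +<+; -[1+_])
open import Data.Integer.Properties
open import Data.Integer.Tactic.RingSolver using (solve; solve-∀)
open import Data.List using ([]; _∷_)
open import Data.Product using (proj₁; proj₂; ∃₂)
open import Data.Sum using (_⊎_; inj₁; inj₂)
open import Function.Bundles using (mk⇔)
open import Relation.Nullary using (yes; no; ¬_)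
open import Relation.Nullary.Decidable using (decidable-stable)
open import Relation.Binary.PropositionalEquality using (_≡_; refl; sym; trans; cong; cong₂; subst)

0≤+ : ∀ {i j} → + 0 ≤ i → + 0 ≤ j → + 0 ≤ i + j
0≤+ = +-mono-≤

0≤* : ∀ {i j} → + 0 ≤ i → + 0 ≤ j → + 0 ≤ i * j
0≤* {+ m} {+ n} _ _ = subst (+ 0 ≤_) (pos-* m n) (+≤+ N.z≤n)

0≤1 : + 0 ≤ + 1
0≤1 = +≤+ N.z≤n

0≤0 : + 0 ≤ + 0
0≤0 = ≤-refl

i≰0⇒0≤i-1 : ∀ {i} → ¬ (i ≤ + 0) → + 0 ≤ i - + 1
i≰0⇒0≤i-1 {i} i≰0 = i≤j⇒0≤j-i {+ 1} (i<j⇒suc[i]≤j (≰⇒> i≰0))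

nonPos-by-combination : ∀ {g h} c r → + 0 ≤ c → + 0 ≤ r → h ≤ + 0 →
                        - g ≡ c * - h + r → g ≤ + 0
nonPos-by-combination c r 0≤c 0≤r h≤0 eq =
  neg-cancel-≤ (subst (+ 0 ≤_) (sym eq) (0≤+ (0≤* 0≤c (neg-mono-≤ h≤0)) 0≤r))

1≰0 : ¬ (+ 1 ≤ + 0)
1≰0 (+≤+ ())

<⇒≤-1 : ∀ {i j} → i < j → i ≤ j - + 1
<⇒≤-1 {i} {j} i<j = subst (i ≤_) (+-comm (-[1+ 0 ]) j) (i<j⇒i≤pred[j] i<j)

≤-1⇒< : ∀ {i j} → i ≤ j - + 1 → i < j
≤-1⇒< {i} {j} i≤j-1 = i≤pred[j]⇒i<j (subst (i ≤_) (+-comm j (-[1+ 0 ])) i≤j-1)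

<⇒+1≤ : ∀ {i j} → i < j → i + + 1 ≤ j
<⇒+1≤ {i} {j} i<j = subst (_≤ j) (+-comm (+ 1) i) (i<j⇒suc[i]≤j i<j)

+1≤⇒< : ∀ {i j} → i + + 1 ≤ j → i < j
+1≤⇒< {i} {j} i+1≤j = suc[i]≤j⇒i<j (subst (_≤ j) (+-comm i (+ 1)) i+1≤j)

≤⇒<⊎≡ : ∀ {i j} → i ≤ j → i < j ⊎ i ≡ j
≤⇒<⊎≡ {i} {j} i≤j with i ≟ j
... | yes i≡j = inj₂ i≡j
... | no i≢j = inj₁ (≤∧≢⇒< i≤j i≢j)

euclidean-division : ∀ p .{{_ : N.NonZero p}} {c} → + 0 ≤ c →
  ∃₂ λ a b → + 0 ≤ a × + 0 ≤ b × b ≤ + p - + 1 × c ≡ a * + p + b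
euclidean-division p {+ c} _ =
  + (c ℕ./ p) , + (c ℕ.% p) , +≤+ N.z≤n , +≤+ N.z≤n , <⇒≤-1 (+<+ (ℕ.m%n<n c p)) , c≡
  where
  c≡ : + c ≡ + (c ℕ./ p) * + p + + (c ℕ.% p)
  c≡ = trans (cong +_ (trans (ℕ.m≡m%n+[m/n]*n c p) (ℕ.+-comm (c ℕ.% p) _)))
             (trans (pos-+ ((c ℕ./ p) N.* p) _) (cong (_+ + (c ℕ.% p)) (pos-* (c ℕ./ p) p)))

i-[j+k]≡i-j-k : ∀ i j k → i - (j + k) ≡ i - j - k
i-[j+k]≡i-j-k = solve-∀

i-j-k+[j+k]≡i : ∀ i j k → i - j - k + (j + k) ≡ i
i-j-k+[j+k]≡i = solve-∀

i+j≡k⇒k-j≡i : ∀ i j {k} → i + j ≡ k → k - j ≡ i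
i+j≡k⇒k-j≡i i j refl = solve (i ∷ j ∷ [])

i+j≡k⇒i-k≡-j : ∀ i j {k} → i + j ≡ k → i - k ≡ - j
i+j≡k⇒i-k≡-j i j refl = solve (i ∷ j ∷ [])

i-j≡k⇒j+k≡i : ∀ i j {k} → i - j ≡ k → j + k ≡ i
i-j≡k⇒j+k≡i i j refl = solve (i ∷ j ∷ [])

0≤j⇒i≤i+j : ∀ {i j} → + 0 ≤ j → i ≤ i + j
0≤j⇒i≤i+j {i} {j} 0≤j = subst (_≤ i + j) (+-identityʳ i) (+-monoʳ-≤ i 0≤j)

0≤j⇒i-j≤i : ∀ {i j} → + 0 ≤ j → i - j ≤ i
0≤j⇒i-j≤i {i} {j} 0≤j = subst (i - j ≤_) (+-identityʳ i) (+-monoʳ-≤ i (neg-mono-≤ 0≤j))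

sub2-add2 : ∀ u v w → sub2 u (add2 v w) ≡ sub2 (sub2 u v) w
sub2-add2 (x , y) (x' , y') (a , b) = cong₂ _,_ (i-[j+k]≡i-j-k x x' a) (i-[j+k]≡i-j-k y y' b)

module Cones (P : ℤ) (1≤P : + 1 ≤ P) where

  0≤P : + 0 ≤ P
  0≤P = ≤-trans 0≤1 1≤P

  0≤P-1 : + 0 ≤ P - + 1
  0≤P-1 = i≤j⇒0≤j-i 1≤P

  0≤P³-1 : + 0 ≤ P * P * P - + 1
  0≤P³-1 = subst (+ 0 ≤_) factor (0≤* 0≤P-1 (0≤+ (0≤+ (0≤* 0≤P 0≤P) 0≤P) 0≤1))
    where
    factor : (P - + 1) * (P * P + P + + 1) ≡ P * P * P - + 1
    factor = solve (P ∷ [])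

  InΔ⇒InD-shifted : ∀ x y z → InΔ P (x , y , z) → InD P (x - + 0 , y - - (z * P))
  InΔ⇒InD-shifted x y z (h₁ , h₂ , _) =
    nonPos-by-combination (+ 1) (+ 0) 0≤1 0≤0 h₁ (solve (x ∷ y ∷ z ∷ P ∷ [])) ,
    nonPos-by-combination (+ 1) (+ 0) 0≤1 0≤0 h₂ (solve (x ∷ y ∷ z ∷ P ∷ []))

  InD-shifted⇒InΔ : ∀ x y z → + 0 ≤ z → InD P (x - + 0 , y - - (z * P)) → InΔ P (x , y , z)
  InD-shifted⇒InΔ x y z 0≤z (h₁ , h₂) =
    nonPos-by-combination (+ 1) (+ 0) 0≤1 0≤0 h₁ (solve (x ∷ y ∷ z ∷ P ∷ [])) ,
    nonPos-by-combination (+ 1) (+ 0) 0≤1 0≤0 h₂ (solve (x ∷ y ∷ z ∷ P ∷ [])) ,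
    nonPos-by-combination P ((P * P * P - + 1) * z) 0≤P (0≤* 0≤P³-1 0≤z) h₁
      (solve (x ∷ y ∷ z ∷ P ∷ []))

  InΔ-flat⇒InD : ∀ x y → InΔ P (x , y , + 0) → InD P (x , y)
  InΔ-flat⇒InD x y (h₁ , h₂ , _) =
    nonPos-by-combination (+ 1) (+ 0) 0≤1 0≤0 h₁ (solve (x ∷ y ∷ P ∷ [])) ,
    nonPos-by-combination (+ 1) (+ 0) 0≤1 0≤0 h₂ (solve (x ∷ y ∷ P ∷ []))

  InD⇒InΔ-below₁ : ∀ x y a b → + 0 ≤ a → + 0 ≤ b →
                   InD P (x - a , y - + 0) → InΔ P (x , y , - (a * P + b))
  InD⇒InΔ-below₁ x y a b 0≤a 0≤b (h₁ , h₂) =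
    nonPos-by-combination (+ 1) ((P * P * P - + 1) * a + P * P * b) 0≤1
      (0≤+ (0≤* 0≤P³-1 0≤a) (0≤* (0≤* 0≤P 0≤P) 0≤b)) h₁ (solve (x ∷ y ∷ a ∷ b ∷ P ∷ [])) ,
    nonPos-by-combination (+ 1) (P * b) 0≤1 (0≤* 0≤P 0≤b) h₂
      (solve (x ∷ y ∷ a ∷ b ∷ P ∷ [])) ,
    nonPos-by-combination P b 0≤P 0≤b h₁ (solve (x ∷ y ∷ a ∷ b ∷ P ∷ []))

  InD⇒InΔ-below₂ : ∀ x y a b → + 0 ≤ a → b ≤ P - + 1 →
                   InD P (x - (a + + 1) , y - (- (P * P) + P * b)) → InΔ P (x , y , - (a * P + b))
  InD⇒InΔ-below₂ x y a b 0≤a b≤P-1 (h₁ , h₂) =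
    nonPos-by-combination (+ 1) ((a + + 1) * (P * P * P - + 1)) 0≤1
      (0≤* (0≤+ 0≤a 0≤1) 0≤P³-1) h₁ (solve (x ∷ y ∷ a ∷ b ∷ P ∷ [])) ,
    nonPos-by-combination (+ 1) (+ 0) 0≤1 0≤0 h₂ (solve (x ∷ y ∷ a ∷ b ∷ P ∷ [])) ,
    nonPos-by-combination P ((P * P * P - + 1) * (P - b)) 0≤P (0≤* 0≤P³-1 0≤P-b) h₁
      (solve (x ∷ y ∷ a ∷ b ∷ P ∷ []))
    where
    0≤P-b : + 0 ≤ P - b
    0≤P-b = i≤j⇒0≤j-i (≤-trans b≤P-1 (i≤j⇒i-k≤j {P} (+ 1) ≤-refl))

  -- The third inequality of Δ reads P·d₁ − b ≤ 0, where d₁ is the first inequality of D at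
  -- (x − a, y); as 0 ≤ b < P and everything is integral, d₁ ≤ 0.
  InΔ-below⇒InD₁ : ∀ x y a b → b ≤ P - + 1 → P * x + P * P * y + - (a * P + b) ≤ + 0 →
                   x - a + P * (y - + 0) ≤ + 0
  InΔ-below⇒InD₁ x y a b b≤P-1 h₃ = decidable-stable (_ ≤? + 0) λ d₁≰0 →
    1≰0 (nonPos-by-combination (+ 1) (P * (x - a + P * (y - + 0) - + 1) + (P - + 1 - b)) 0≤1
      (0≤+ (0≤* 0≤P (i≰0⇒0≤i-1 d₁≰0)) (i≤j⇒0≤j-i b≤P-1)) h₃ (solve (x ∷ y ∷ a ∷ b ∷ P ∷ [])))

  -- P·d₂ − d₁ = (P³ − 1)(x − a) for the two inequalities d₁, d₂ of D at (x − a, y).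
  InD₁-¬InD₂⇒0<x-a : ∀ x y a → x - a + P * (y - + 0) ≤ + 0 →
                     ¬ (P * P * (x - a) + (y - + 0) ≤ + 0) → + 0 ≤ x - a - + 1
  InD₁-¬InD₂⇒0<x-a x y a d₁ d₂≰0 = i≰0⇒0≤i-1 λ x-a≤0 →
    1≰0 (nonPos-by-combination (+ 1)
      ((P * P * P - + 1) * - (x - a) + P * (P * P * (x - a) + (y - + 0) - + 1) + (P - + 1)) 0≤1
      (0≤+ (0≤+ (0≤* 0≤P³-1 (neg-mono-≤ x-a≤0)) (0≤* 0≤P (i≰0⇒0≤i-1 d₂≰0))) 0≤P-1) d₁
      (solve (x ∷ y ∷ a ∷ P ∷ [])))

  InΔ-below⇒InD-next : ∀ x y a b → P * P * x + y + P * - (a * P + b) ≤ + 0 →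
                       + 0 ≤ x - a - + 1 → InD P (x - (a + + 1) , y - (- (P * P) + P * b))
  InΔ-below⇒InD-next x y a b h₂ 0<x-a =
    nonPos-by-combination P ((P * P * P - + 1) * (x - a - + 1)) 0≤P (0≤* 0≤P³-1 0<x-a) h₂
      (solve (x ∷ y ∷ a ∷ b ∷ P ∷ [])) ,
    nonPos-by-combination (+ 1) (+ 0) 0≤1 0≤0 h₂ (solve (x ∷ y ∷ a ∷ b ∷ P ∷ []))

  InΔ-below⇒InD : ∀ x y a b → b ≤ P - + 1 → InΔ P (x , y , - (a * P + b)) →
                  InD P (x - a , y - + 0) ⊎ InD P (x - (a + + 1) , y - (- (P * P) + P * b))
  InΔ-below⇒InD x y a b b≤P-1 (_ , h₂ , h₃)
    with InΔ-below⇒InD₁ x y a b b≤P-1 h₃ | P * P * (x - a) + (y - + 0) ≤? + 0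
  ... | d₁ | yes d₂ = inj₁ (d₁ , d₂)
  ... | d₁ | no d₂≰0 =
    inj₂ (InΔ-below⇒InD-next x y a b h₂ (InD₁-¬InD₂⇒0<x-a x y a d₁ d₂≰0))

_at_ : Pt2 → ℤ → Pt3
(x , y) at k = x , y , k

module Layers (p : ℕ) .{{_ : N.NonZero p}} (n : ℤ) (J : ℤ → Sub Pt2) where

  P : ℤ
  P = + p

  open Cones P (+≤+ (N.>-nonZero⁻¹ p))

  Closed : ℤ → ℤ → Set
  Closed s t = ∀ u v → J s u → U n v → (v at t) ≺₃[ P ] (u at s) → J t v

  ShiftsDown : ℤ → ℤ → ℤ → ℤ → Set
  ShiftsDown s t a b =
    ShiftIncl P n (J s) (a , + 0) (J t) × ShiftIncl P n (J s) (a + + 1 , - (P * P) + P * b) (J t)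

  ShiftsUpInto : ℤ → Set
  ShiftsUpInto i = (j : ℤ) → + 0 ≤ j → j < i → ShiftIncl P n (J j) (+ 0 , - ((i - j) * P)) (J i)

  ShiftsDownFrom : ℤ → Set
  ShiftsDownFrom i =
    (a b : ℤ) → + 0 ≤ a → + 0 ≤ b → b ≤ P - + 1 → a * P + b ≤ i → ShiftsDown i (i - a * P - b) a b

  ShiftsUpFrom : ℤ → Set
  ShiftsUpFrom i = (j : ℤ) → i < j → j ≤ n → ShiftIncl P n (J i) (+ 0 , - ((j - i) * P)) (J j)

  ShiftsDownInto : ℤ → Set
  ShiftsDownInto i =
    (a b : ℤ) → + 0 ≤ a → + 0 ≤ b → b ≤ P - + 1 → i + a * P + b ≤ n → ShiftsDown (i + a * P + b) i a b

  ShiftsDownBetween : ℤ → ℤ → Set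
  ShiftsDownBetween s t =
    ∀ {a b} → + 0 ≤ a → + 0 ≤ b → b ≤ P - + 1 → t + (a * P + b) ≡ s → ShiftsDown s t a b

  shiftUp⇒closed : ∀ {s t} → ShiftIncl P n (J s) (+ 0 , - ((t - s) * P)) (J t) → Closed s t
  shiftUp⇒closed {s} {t} incl u@(x , y) v@(x' , y') Ju Uv v≺u =
    incl v (Uv , u , Ju ,
      subst (InD P) (sym (sub2-add2 v u _)) (InΔ⇒InD-shifted (x' - x) (y' - y) (t - s) v≺u))

  closed⇒shiftUp : ∀ {s t} → s ≤ t → Closed s t →
                   ShiftIncl P n (J s) (+ 0 , - ((t - s) * P)) (J t)
  closed⇒shiftUp {s} {t} s≤t closed v@(x' , y') (Uv , u@(x , y) , Ju , v∈u+w+D) =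
    closed u v Ju Uv (InD-shifted⇒InΔ (x' - x) (y' - y) (t - s) (i≤j⇒0≤j-i s≤t)
      (subst (InD P) (sub2-add2 v u _) v∈u+w+D))

  closed⇒shiftsDown : ∀ {s t a b} → + 0 ≤ a → + 0 ≤ b → b ≤ P - + 1 → t + (a * P + b) ≡ s →
                      Closed s t → ShiftsDown s t a b
  closed⇒shiftsDown {s} {t} {a} {b} 0≤a 0≤b b≤P-1 t+c≡s closed = below₁ , below₂
    where
    at-depth : ∀ {x y} → InΔ P (x , y , - (a * P + b)) → InΔ P (x , y , t - s)
    at-depth {x} {y} = subst (λ z → InΔ P (x , y , z)) (sym (i+j≡k⇒i-k≡-j t (a * P + b) t+c≡s))

    below₁ : ShiftIncl P n (J s) (a , + 0) (J t)
    below₁ v@(x' , y') (Uv , u@(x , y) , Ju , v∈u+w+D) = closed u v Ju Uv (at-depth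
      (InD⇒InΔ-below₁ (x' - x) (y' - y) a b 0≤a 0≤b
        (subst (InD P) (sub2-add2 v u _) v∈u+w+D)))

    below₂ : ShiftIncl P n (J s) (a + + 1 , - (P * P) + P * b) (J t)
    below₂ v@(x' , y') (Uv , u@(x , y) , Ju , v∈u+w+D) = closed u v Ju Uv (at-depth
      (InD⇒InΔ-below₂ (x' - x) (y' - y) a b 0≤a b≤P-1
        (subst (InD P) (sub2-add2 v u _) v∈u+w+D)))

  shiftsDown⇒closed : ∀ {s t} → t < s → ShiftsDownBetween s t → Closed s t
  shiftsDown⇒closed {s} {t} t<s shifts u@(x , y) v@(x' , y') Ju Uv v≺u
    with euclidean-division p (i≤j⇒0≤j-i (<⇒≤ t<s))
  ... | a , b , 0≤a , 0≤b , b≤P-1 , s-t≡c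
    with i-j≡k⇒j+k≡i s t s-t≡c
  ... | t+c≡s
    with shifts 0≤a 0≤b b≤P-1 t+c≡s
       | InΔ-below⇒InD (x' - x) (y' - y) a b b≤P-1
           (subst (λ z → InΔ P (x' - x , y' - y , z)) (i+j≡k⇒i-k≡-j t (a * P + b) t+c≡s) v≺u)
  ... | below₁ , _ | inj₁ v∈ = below₁ v (Uv , u , Ju , subst (InD P) (sym (sub2-add2 v u _)) v∈)
  ... | _ , below₂ | inj₂ v∈ = below₂ v (Uv , u , Ju , subst (InD P) (sym (sub2-add2 v u _)) v∈)

  consistent⇒closed : ∀ {lo hi s t} → Consistent P n J lo hi →
                      InInterval lo hi s → InInterval lo hi t → Closed s t
  consistent⇒closed (_ , ideal) s∈ t∈ (x , y) (x' , y') Ju Uv v≺u =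
    proj₂ (ideal (x , y , _) (x' , y' , _) (s∈ , Ju) (Uv , t∈) v≺u)

  closed⇒consistent : ∀ {lo hi} → (∀ {k} → InInterval lo hi k → J k ⊆ U n) →
                      (∀ {s t} → InInterval lo hi s → InInterval lo hi t → Closed s t) →
                      Consistent P n J lo hi
  closed⇒consistent inU closed =
    (λ { (x , y , k) (k∈ , Jk) → inU k∈ (x , y) Jk , k∈ }) ,
    (λ { (x , y , s) (x' , y' , t) (s∈ , Ju) (Uv , t∈) v≺u →
         t∈ , closed s∈ t∈ (x , y) (x' , y') Ju Uv v≺u })

  idealU⇒closed : ∀ {k} → IdealU P n (J k) → Closed k k
  idealU⇒closed {k} (_ , ideal) u@(x , y) v@(x' , y') Ju Uv v≺u = ideal u v Ju Uv
    (InΔ-flat⇒InD (x' - x) (y' - y)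
      (subst (λ z → InΔ P (x' - x , y' - y , z)) (+-inverseʳ k) v≺u))

  consistent-extend : ∀ {lo hi lo′ hi′ k} →
    (∀ {j} → InInterval lo hi j → InInterval lo′ hi′ j ⊎ j ≡ k) →
    Consistent P n J lo′ hi′ → IdealU P n (J k) →
    (∀ {j} → InInterval lo′ hi′ j → Closed j k × Closed k j) →
    Consistent P n J lo hi
  consistent-extend {lo} {hi} {lo′} {hi′} {k} split C idealₖ cross = closed⇒consistent inU closed
    where
    inU : ∀ {j} → InInterval lo hi j → J j ⊆ U n
    inU j∈ with split j∈
    ... | inj₁ j∈′ = λ { (x , y) Jj → proj₁ (proj₁ C (x , y , _) (j∈′ , Jj)) }
    ... | inj₂ refl = proj₁ idealₖ

    closed : ∀ {s t} → InInterval lo hi s → InInterval lo hi t → Closed s t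
    closed s∈ t∈ with split s∈ | split t∈
    ... | inj₁ s∈′ | inj₁ t∈′ = consistent⇒closed C s∈′ t∈′
    ... | inj₁ s∈′ | inj₂ refl = proj₁ (cross s∈′)
    ... | inj₂ refl | inj₁ t∈′ = proj₂ (cross t∈′)
    ... | inj₂ refl | inj₂ refl = idealU⇒closed idealₖ

  consistent-snoc⇔ : ∀ {i} → + 0 ≤ i → IdealU P n (J i) → Consistent P n J (+ 0) (i - + 1) →
                     Consistent P n J (+ 0) i ⇔ (ShiftsUpInto i × ShiftsDownFrom i)
  consistent-snoc⇔ {i} 0≤i idealᵢ C =
    mk⇔ (λ C′ → up C′ , down C′) (λ (up , down) → consistent-extend split C idealᵢ (cross up down))
    where
    i∈ : InInterval (+ 0) i i
    i∈ = 0≤i , ≤-refl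

    up : Consistent P n J (+ 0) i → ShiftsUpInto i
    up C′ j 0≤j j<i = closed⇒shiftUp (<⇒≤ j<i) (consistent⇒closed C′ (0≤j , <⇒≤ j<i) i∈)

    down : Consistent P n J (+ 0) i → ShiftsDownFrom i
    down C′ a b 0≤a 0≤b b≤P-1 c≤i =
      closed⇒shiftsDown 0≤a 0≤b b≤P-1 (i-j-k+[j+k]≡i i (a * P) b)
        (consistent⇒closed C′ i∈ (0≤t , t≤i))
      where
      0≤t : + 0 ≤ i - a * P - b
      0≤t = subst (+ 0 ≤_) (i-[j+k]≡i-j-k i (a * P) b) (i≤j⇒0≤j-i c≤i)
      t≤i : i - a * P - b ≤ i
      t≤i = subst (_≤ i) (i-[j+k]≡i-j-k i (a * P) b) (0≤j⇒i-j≤i (0≤+ (0≤* 0≤a 0≤P) 0≤b))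

    split : ∀ {j} → InInterval (+ 0) i j → InInterval (+ 0) (i - + 1) j ⊎ j ≡ i
    split (0≤j , j≤i) with ≤⇒<⊎≡ j≤i
    ... | inj₁ j<i = inj₁ (0≤j , <⇒≤-1 j<i)
    ... | inj₂ j≡i = inj₂ j≡i

    cross : ShiftsUpInto i → ShiftsDownFrom i →
            ∀ {j} → InInterval (+ 0) (i - + 1) j → Closed j i × Closed i j
    cross up down {j} (0≤j , j≤i-1) = shiftUp⇒closed (up j 0≤j j<i) , shiftsDown⇒closed j<i shifts
      where
      j<i : j < i
      j<i = ≤-1⇒< j≤i-1

      shifts : ShiftsDownBetween i j
      shifts {a} {b} 0≤a 0≤b b≤P-1 j+c≡i =
        subst (λ t → ShiftsDown i t a b) t≡j (down a b 0≤a 0≤b b≤P-1 c≤i)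
        where
        i-c≡j : i - (a * P + b) ≡ j
        i-c≡j = i+j≡k⇒k-j≡i j (a * P + b) j+c≡i
        t≡j : i - a * P - b ≡ j
        t≡j = trans (sym (i-[j+k]≡i-j-k i (a * P) b)) i-c≡j
        c≤i : a * P + b ≤ i
        c≤i = 0≤i-j⇒j≤i (subst (+ 0 ≤_) (sym i-c≡j) 0≤j)

  consistent-cons⇔ : ∀ {i} → i ≤ n → IdealU P n (J i) → Consistent P n J (i + + 1) n →
                     Consistent P n J i n ⇔ (ShiftsUpFrom i × ShiftsDownInto i)
  consistent-cons⇔ {i} i≤n idealᵢ C =
    mk⇔ (λ C′ → up C′ , down C′) (λ (up , down) → consistent-extend split C idealᵢ (cross up down))
    where
    i∈ : InInterval i n i
    i∈ = ≤-refl , i≤n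

    up : Consistent P n J i n → ShiftsUpFrom i
    up C′ j i<j j≤n = closed⇒shiftUp (<⇒≤ i<j) (consistent⇒closed C′ i∈ (<⇒≤ i<j , j≤n))

    down : Consistent P n J i n → ShiftsDownInto i
    down C′ a b 0≤a 0≤b b≤P-1 s≤n =
      closed⇒shiftsDown 0≤a 0≤b b≤P-1 (sym (+-assoc i (a * P) b))
        (consistent⇒closed C′ (i≤s , s≤n) i∈)
      where
      i≤s : i ≤ i + a * P + b
      i≤s = subst (i ≤_) (sym (+-assoc i (a * P) b)) (0≤j⇒i≤i+j (0≤+ (0≤* 0≤a 0≤P) 0≤b))

    split : ∀ {j} → InInterval i n j → InInterval (i + + 1) n j ⊎ j ≡ i
    split (i≤j , j≤n) with ≤⇒<⊎≡ i≤j
    ... | inj₁ i<j = inj₁ (<⇒+1≤ i<j , j≤n)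
    ... | inj₂ i≡j = inj₂ (sym i≡j)

    cross : ShiftsUpFrom i → ShiftsDownInto i →
            ∀ {j} → InInterval (i + + 1) n j → Closed j i × Closed i j
    cross up down {j} (i+1≤j , j≤n) = shiftsDown⇒closed i<j shifts , shiftUp⇒closed (up j i<j j≤n)
      where
      i<j : i < j
      i<j = +1≤⇒< i+1≤j

      shifts : ShiftsDownBetween j i
      shifts {a} {b} 0≤a 0≤b b≤P-1 i+c≡j =
        subst (λ s → ShiftsDown s i a b) s≡j (down a b 0≤a 0≤b b≤P-1 (subst (_≤ n) (sym s≡j) j≤n))
        where
        s≡j : i + a * P + b ≡ j
        s≡j = trans (+-assoc i (a * P) b) i+c≡j

lemma4p1 : (p m : ℕ) → Prime p → 0 N.< m → 3 ∣ m →
    let n = + ((m / 3) N.* (p N.∸ 1)) in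
    let P = + p in
    (i : ℤ) → + 0 ≤ i → i ≤ n →
    (J : ℤ → Sub Pt2) → IdealU P n (J i) →
    (((∀ j → + 0 ≤ j → j < i → IdealU P n (J j)) →
      Consistent P n J (+ 0) (i - + 1) →
      Consistent P n J (+ 0) i ⇔
        (((j : ℤ) → + 0 ≤ j → j < i →
            ShiftIncl P n (J j) (+ 0 , - ((i - j) * P)) (J i))
         × ((a b : ℤ) → + 0 ≤ a → + 0 ≤ b → b ≤ P - + 1 → a * P + b ≤ i →
            ShiftIncl P n (J i) (a , + 0) (J (i - a * P - b))
            × ShiftIncl P n (J i) (a + + 1 , - (P * P) + P * b) (J (i - a * P - b)))))
    × ((∀ j → i < j → j ≤ n → IdealU P n (J j)) →
      Consistent P n J (i + + 1) n →
      Consistent P n J i n ⇔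
        (((j : ℤ) → i < j → j ≤ n →
            ShiftIncl P n (J i) (+ 0 , - ((j - i) * P)) (J j))
         × ((a b : ℤ) → + 0 ≤ a → + 0 ≤ b → b ≤ P - + 1 → i + a * P + b ≤ n →
            ShiftIncl P n (J (i + a * P + b)) (a , + 0) (J i)
            × ShiftIncl P n (J (i + a * P + b)) (a + + 1 , - (P * P) + P * b) (J i)))))
lemma4p1 p m p-prime _ _ i 0≤i i≤n J idealᵢ =
  (λ _ → consistent-snoc⇔ 0≤i idealᵢ) , (λ _ → consistent-cons⇔ i≤n idealᵢ)
  where open Layers p {{prime⇒nonZero p-prime}} (+ ((m / 3) N.* (p N.∸ 1))) J
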